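{- Let $G$ be a finite group of order $v$ and let $\{B,\overline B\}$, with $\overline B=G\setminus B$, be a partitioned difference family in $G$ with exactly two blocks. Then $B$ is a difference set in $G$ (and $\overline B$ is its complement). Moreover, if the partitioned difference family $\{B,\overline B\}$ is Hadamard, then one of its two blocks is a Hadamard difference set, i.e. a $(4u^2,2u^2-u,u^2-u)$ difference set for some integer $u$, and the other block is its complement.
   Context: Groups are written additively (not necessarily abelian). For a subset $B$ of $G$, $\Delta B$ is the multiset $\{x-y: x,y\in B, x\ne y\}$; for a collection $\mathcal F=\{B_1,\dots,B_t\}$, $\Delta\mathcal F=\bigcup_i \Delta B_i$ (multiset union). $\mathcal F$ is a $(G,[k_1,\dots,k_t],\lambda)$ difference family if $|B_i|=k_i$ and $\Delta\mathcal F$ covers every non-zero element of $G$ exactly $\lambda$ times. A $(v,k,\lambda)$ difference set is a single $k$-subset $B$ of a group of order $v$ with $\Delta B$ covering every non-zero element exactly $\lambda$ times. A difference family is partitioned (PDF) if its blocks partition $G$. A PDF is Hadamard (HPDF) if $|G|=2\lambda$. A Hadamard difference set is one with parameters $(4u^2,2u^2-u,u^2-u)$. -}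

module Defs where

open import Data.Nat using (ℕ; _+_)
open import Data.Fin using (Fin)
open import Data.Fin.Properties using (_≟_)
open import Data.Fin.Subset using (Subset; _∈_; ∁; ∣_∣)
open import Data.Fin.Subset.Properties using (_∈?_)
open import Data.List using (List; allFin; cartesianProduct; filter; length)
open import Data.Product using (_×_; _,_; proj₁; proj₂; ∃)
open import Relation.Binary.PropositionalEquality using (_≡_)
open import Relation.Nullary using (¬_; Dec; yes; no)
open import Relation.Nullary.Decidable using (_×-dec_; ¬?)
open import Algebra.Structures using (IsGroup)
open import Level using (0ℓ)

-- A finite group of order v, written additively: carrier Fin v
-- (every finite group of order v is isomorphic to one of this form).
-- Not assumed abelian.
record FinGroup (v : ℕ) : Set where
  field
    _⊕_ : Fin v → Fin v → Fin v
    0#  : Fin v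
    -_  : Fin v → Fin v
    isGroup : IsGroup _≡_ _⊕_ 0# -_

  infixl 6 _-_
  _-_ : Fin v → Fin v → Fin v
  x - y = x ⊕ (- y)

module _ {v : ℕ} (G : FinGroup v) where
  open FinGroup G

  mult : Subset v → Fin v → ℕ
  mult B g = length (filter P? (cartesianProduct (allFin v) (allFin v)))
    where
    P? : (p : Fin v × Fin v) → Dec ((proj₁ p ∈ B × proj₂ p ∈ B) × (¬ proj₁ p ≡ proj₂ p × proj₁ p - proj₂ p ≡ g))
    P? (x , y) = ((x ∈? B) ×-dec (y ∈? B)) ×-dec (¬? (x ≟ y) ×-dec ((x - y) ≟ g))

  IsDiffFamily₂ : Subset v → ℕ → Set
  IsDiffFamily₂ B lam = ∀ g → ¬ g ≡ 0# → mult B g + mult (∁ B) g ≡ lam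

  -- partitioned difference family with exactly the two blocks B and ∁ B
  -- (blocks of a partition are nonempty; disjointness and covering hold by construction)
  IsPDF₂ : Subset v → ℕ → Set
  IsPDF₂ B lam = (∃ λ x → x ∈ B) × (∃ λ x → x ∈ ∁ B) × IsDiffFamily₂ B lam

  IsDiffSet : Subset v → ℕ → ℕ → Set
  IsDiffSet B k lam = ∣ B ∣ ≡ k × (∀ g → ¬ g ≡ 0# → mult B g ≡ lam)

-- For g ≠ 0 let A_C(g) be the number of pairs (x, y) ∈ C² with x − y = g.  Sorting the v pairs
-- with difference g by how many of x, y lie in B gives A_∁B(g) = v − 2∣B∣ + A_B(g), so the
-- condition λ = A_B(g) + A_∁B(g) forces A_B(g) to be the same for every g ≠ 0: B is a difference
-- set, with index μ say.  Counting all pairs of distinct elements of B gives k(k − 1) = μ(v − 1)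
-- for k = ∣B∣; if moreover v = 2λ, then λ = v − 2k + 2μ yields v = 4(k − μ), and the two
-- relations combine to (k − 2μ)² = k − μ.  Hence u = k − 2μ satisfies v = 4u², k = 2u² − u and
-- μ = u² − u.

module Submission where

open import Defs
open import Algebra.Bundles using (Group)
open import Algebra.Structures using (IsGroup)
import Algebra.Properties.Group as GroupProperties
open import Data.Bool using (true; false; if_then_else_)
open import Data.Fin using (Fin; zero; suc)
open import Data.Fin.Properties using (_≟_)
open import Data.Fin.Permutation using (permutation)
open import Data.Fin.Subset using (Subset; _∈_; ∁; ∣_∣; inside; outside)
open import Data.Fin.Subset.Properties using (_∈?_; x∈∁p⇒x∉p; x∉p⇒x∈∁p)
open import Data.Integer using (ℤ; +_; _-_) renaming (_+_ to _+ℤ_; _*_ to _*ℤ_)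
open import Data.Integer.Properties using (pos-*)
open import Data.Integer.Tactic.RingSolver renaming (solve-∀ to solve-∀ℤ)
open import Data.List using (List; length; filter; tabulate; cartesianProduct; map; _++_)
open import Data.List.Properties using (filter-++; length-++; map-tabulate)
open import Data.Nat using (ℕ; zero; suc; _+_; _*_)
open import Data.Nat.Tactic.RingSolver using (solve-∀)
open import Data.Nat.Properties
  using (+-*-semiring; +-identityʳ; *-identityʳ; *-zeroʳ; +-comm; +-cancelˡ-≡; *-cancelˡ-≡)
open import Algebra.Properties.Semiring.Sum +-*-semiring
  using (sum-syntax; ∑-distrib-+; ∑-comm; *-distribˡ-sum; *-distribʳ-sum; sum-cong-≗; sum-permute; sum-replicate-zero)
open import Data.Product using (_×_; _,_; ∃)
open import Data.Sum using (_⊎_; inj₁)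
open import Data.Vec using ([]; _∷_)
open import Function using (id; _∘_; _⇔_; mk⇔)
open import Level using (0ℓ)
open import Relation.Binary.PropositionalEquality
open import Relation.Nullary using (Dec; yes; no; does; ¬_; _×-dec_; ¬?)
open import Relation.Nullary.Decidable using (does-⇔)
open import Relation.Unary using (Pred; Decidable)

⟦_⟧ : ∀ {p} {P : Set p} → Dec P → ℕ
⟦ P? ⟧ = if does P? then 1 else 0

module _ {p q} {P : Set p} {Q : Set q} where

  ⟦⟧-cong : P ⇔ Q → (P? : Dec P) (Q? : Dec Q) → ⟦ P? ⟧ ≡ ⟦ Q? ⟧
  ⟦⟧-cong P⇔Q P? Q? = cong (if_then 1 else 0) (does-⇔ P⇔Q P? Q?)

  ⟦×-dec⟧ : (P? : Dec P) (Q? : Dec Q) → ⟦ P? ×-dec Q? ⟧ ≡ ⟦ P? ⟧ * ⟦ Q? ⟧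
  ⟦×-dec⟧ (yes _) Q? = sym (+-identityʳ ⟦ Q? ⟧)
  ⟦×-dec⟧ (no _)  Q? = refl

  inclusion-exclusion : (P? : Dec P) (Q? : Dec Q) →
    ⟦ ¬? P? ⟧ * ⟦ ¬? Q? ⟧ + ⟦ P? ⟧ + ⟦ Q? ⟧ ≡ 1 + ⟦ P? ⟧ * ⟦ Q? ⟧
  inclusion-exclusion (yes _) (yes _) = refl
  inclusion-exclusion (yes _) (no _)  = refl
  inclusion-exclusion (no _)  (yes _) = refl
  inclusion-exclusion (no _)  (no _)  = refl

module _ {p} {P : Set p} where

  ⟦⟧*⟦⟧ : (P? : Dec P) → ⟦ P? ⟧ * ⟦ P? ⟧ ≡ ⟦ P? ⟧
  ⟦⟧*⟦⟧ (yes _) = refl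
  ⟦⟧*⟦⟧ (no _)  = refl

module _ {a p} {A : Set a} {P : Pred A p} (P? : Decidable P) where

  length-filter-tabulate : ∀ {n} (f : Fin n → A) →
    length (filter P? (tabulate f)) ≡ ∑[ i < n ] ⟦ P? (f i) ⟧
  length-filter-tabulate {zero}  f = refl
  length-filter-tabulate {suc n} f with does (P? (f zero))
  ... | true  = cong suc (length-filter-tabulate (f ∘ suc))
  ... | false = length-filter-tabulate (f ∘ suc)

module _ {a b p} {A : Set a} {B : Set b} {P : Pred (A × B) p} (P? : Decidable P) where

  length-filter-cartesianProduct : ∀ {m n} (f : Fin m → A) (h : Fin n → B) →
    length (filter P? (cartesianProduct (tabulate f) (tabulate h)))
      ≡ ∑[ i < m ] ∑[ j < n ] ⟦ P? (f i , h j) ⟧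
  length-filter-cartesianProduct {zero}  f h = refl
  length-filter-cartesianProduct {suc m} f h = begin
    length (filter P? (row ++ rest))                  ≡⟨ cong length (filter-++ P? row rest) ⟩
    length (filter P? row ++ filter P? rest)          ≡⟨ length-++ (filter P? row) ⟩
    length (filter P? row) + length (filter P? rest)  ≡⟨ cong₂ _+_ first-row (length-filter-cartesianProduct (f ∘ suc) h) ⟩
    ∑[ j < _ ] ⟦ P? (f zero , h j) ⟧ + ∑[ i < m ] ∑[ j < _ ] ⟦ P? (f (suc i) , h j) ⟧ ∎
    where
    open ≡-Reasoning
    row rest : List (A × B)
    row  = map (f zero ,_) (tabulate h)
    rest = cartesianProduct (tabulate (f ∘ suc)) (tabulate h)
    first-row : length (filter P? row) ≡ ∑[ j < _ ] ⟦ P? (f zero , h j) ⟧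
    first-row = trans (cong (length ∘ filter P?) (map-tabulate h (f zero ,_)))
                      (length-filter-tabulate P? ((f zero ,_) ∘ h))

∣p∣≡∑⟦∈⟧ : ∀ {n} (p : Subset n) → ∣ p ∣ ≡ ∑[ i < n ] ⟦ i ∈? p ⟧
∣p∣≡∑⟦∈⟧ []            = refl
∣p∣≡∑⟦∈⟧ (inside  ∷ p) = cong suc (∣p∣≡∑⟦∈⟧ p)
∣p∣≡∑⟦∈⟧ (outside ∷ p) = ∣p∣≡∑⟦∈⟧ p

∑-const : ∀ n c → ∑[ i < n ] c ≡ n * c
∑-const zero    c = refl
∑-const (suc n) c = cong (_+_ c) (∑-const n c)

∑-select : ∀ {n} (f : Fin n → ℕ) (a : Fin n) → ∑[ i < n ] (f i * ⟦ i ≟ a ⟧) ≡ f a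
∑-select {suc n} f zero = begin
  f zero * 1 + ∑[ i < n ] (f (suc i) * 0)  ≡⟨ cong₂ _+_ (*-identityʳ (f zero)) (sum-cong-≗ (λ i → *-zeroʳ (f (suc i)))) ⟩
  f zero + ∑[ i < n ] 0                    ≡⟨ cong (_+_ (f zero)) (sum-replicate-zero n) ⟩
  f zero + 0                               ≡⟨ +-identityʳ (f zero) ⟩
  f zero                                   ∎
  where open ≡-Reasoning
∑-select {suc n} f (suc a) =
  trans (cong (_+ ∑[ i < n ] (f (suc i) * ⟦ i ≟ a ⟧)) (*-zeroʳ (f zero))) (∑-select (f ∘ suc) a)

∑-reindex : ∀ {n} (σ τ : Fin n → Fin n) → (∀ i → σ (τ i) ≡ i) → (∀ i → τ (σ i) ≡ i) →
  (f : Fin n → ℕ) → ∑[ i < n ] f (σ i) ≡ ∑[ i < n ] f i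
∑-reindex σ τ στ τσ f = sym (sum-permute f (permutation σ τ στ τσ))

module _ {v : ℕ} (G : FinGroup v) where
  open FinGroup G renaming (_-_ to _⊖_)
  open IsGroup isGroup using (identityˡ)

  group : Group 0ℓ 0ℓ
  group = record
    { Carrier = Fin v ; _≈_ = _≡_ ; _∙_ = _⊕_ ; ε = 0# ; _⁻¹ = -_ ; isGroup = isGroup }

  open GroupProperties group
    using (\\-leftDividesˡ; \\-leftDividesʳ; //-rightDividesˡ; //-rightDividesʳ; x≈y⇒x∙y⁻¹≈ε)

  ≢×-≡⇔≡⊕ : ∀ {x y g} → ¬ g ≡ 0# → (¬ x ≡ y × x ⊖ y ≡ g) ⇔ x ≡ g ⊕ y
  ≢×-≡⇔≡⊕ {x} {y} {g} g≢0 = mk⇔ to from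
    where
    to : ¬ x ≡ y × x ⊖ y ≡ g → x ≡ g ⊕ y
    to (_ , refl) = sym (//-rightDividesˡ y x)
    from : x ≡ g ⊕ y → ¬ x ≡ y × x ⊖ y ≡ g
    from refl = (λ x≡y → g≢0 (trans (sym (//-rightDividesʳ y g)) (x≈y⇒x∙y⁻¹≈ε x≡y))) , //-rightDividesʳ y g

  ∑-translateˡ : ∀ g (f : Fin v → ℕ) → ∑[ y < v ] f (g ⊕ y) ≡ ∑[ y < v ] f y
  ∑-translateˡ g = ∑-reindex (g ⊕_) ((- g) ⊕_) (\\-leftDividesˡ g) (\\-leftDividesʳ g)

  ∑-translateʳ : ∀ y (f : Fin v → ℕ) → ∑[ g < v ] f (g ⊕ y) ≡ ∑[ g < v ] f g
  ∑-translateʳ y = ∑-reindex (_⊕ y) (_⊖ y) (//-rightDividesˡ y) (//-rightDividesʳ y)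

  autocorrelation : Subset v → Fin v → ℕ
  autocorrelation C g = ∑[ y < v ] (⟦ g ⊕ y ∈? C ⟧ * ⟦ y ∈? C ⟧)

  ∑⟦translate-∈⟧ : ∀ g C → ∑[ y < v ] ⟦ g ⊕ y ∈? C ⟧ ≡ ∣ C ∣
  ∑⟦translate-∈⟧ g C = trans (∑-translateˡ g (λ x → ⟦ x ∈? C ⟧)) (sym (∣p∣≡∑⟦∈⟧ C))

  mult≡autocorrelation : ∀ C {g} → ¬ g ≡ 0# → mult G C g ≡ autocorrelation C g
  mult≡autocorrelation C {g} g≢0 = begin
    mult G C g
      ≡⟨ length-filter-cartesianProduct _ {v} {v} id id ⟩
    ∑[ x < v ] ∑[ y < v ] ⟦ pair? x y ⟧
      ≡⟨ ∑-comm (λ x y → ⟦ pair? x y ⟧) ⟩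
    ∑[ y < v ] ∑[ x < v ] ⟦ pair? x y ⟧
      ≡⟨ sum-cong-≗ (λ y → sum-cong-≗ (λ x → ⟦pair?⟧ x y)) ⟩
    ∑[ y < v ] ∑[ x < v ] ((⟦ x ∈? C ⟧ * ⟦ y ∈? C ⟧) * ⟦ x ≟ g ⊕ y ⟧)
      ≡⟨ sum-cong-≗ (λ y → ∑-select (λ x → ⟦ x ∈? C ⟧ * ⟦ y ∈? C ⟧) (g ⊕ y)) ⟩
    autocorrelation C g ∎
    where
    open ≡-Reasoning
    pair? : ∀ x y → Dec ((x ∈ C × y ∈ C) × (¬ x ≡ y × x ⊖ y ≡ g))
    pair? x y = ((x ∈? C) ×-dec (y ∈? C)) ×-dec (¬? (x ≟ y) ×-dec (x ⊖ y ≟ g))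
    ⟦pair?⟧ : ∀ x y → ⟦ pair? x y ⟧ ≡ (⟦ x ∈? C ⟧ * ⟦ y ∈? C ⟧) * ⟦ x ≟ g ⊕ y ⟧
    ⟦pair?⟧ x y = trans (⟦×-dec⟧ ((x ∈? C) ×-dec (y ∈? C)) (¬? (x ≟ y) ×-dec (x ⊖ y ≟ g)))
      (cong₂ _*_ (⟦×-dec⟧ (x ∈? C) (y ∈? C))
                 (⟦⟧-cong (≢×-≡⇔≡⊕ g≢0) (¬? (x ≟ y) ×-dec (x ⊖ y ≟ g)) (x ≟ g ⊕ y)))

  autocorrelation-∁ : ∀ C g → autocorrelation (∁ C) g + ∣ C ∣ + ∣ C ∣ ≡ v + autocorrelation C g
  autocorrelation-∁ C g = begin
    autocorrelation (∁ C) g + ∣ C ∣ + ∣ C ∣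
      ≡⟨ cong₂ (λ s t → autocorrelation (∁ C) g + s + t) (sym (∑⟦translate-∈⟧ g C)) (∣p∣≡∑⟦∈⟧ C) ⟩
    autocorrelation (∁ C) g + ∑[ y < v ] ⟦ g ⊕ y ∈? C ⟧ + ∑[ y < v ] ⟦ y ∈? C ⟧
      ≡⟨ cong (_+ ∑[ y < v ] ⟦ y ∈? C ⟧) (sym (∑-distrib-+ (λ y → ⟦ g ⊕ y ∈? ∁ C ⟧ * ⟦ y ∈? ∁ C ⟧) (λ y → ⟦ g ⊕ y ∈? C ⟧))) ⟩
    ∑[ y < v ] (⟦ g ⊕ y ∈? ∁ C ⟧ * ⟦ y ∈? ∁ C ⟧ + ⟦ g ⊕ y ∈? C ⟧) + ∑[ y < v ] ⟦ y ∈? C ⟧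
      ≡⟨ sym (∑-distrib-+ (λ y → ⟦ g ⊕ y ∈? ∁ C ⟧ * ⟦ y ∈? ∁ C ⟧ + ⟦ g ⊕ y ∈? C ⟧) (λ y → ⟦ y ∈? C ⟧)) ⟩
    ∑[ y < v ] (⟦ g ⊕ y ∈? ∁ C ⟧ * ⟦ y ∈? ∁ C ⟧ + ⟦ g ⊕ y ∈? C ⟧ + ⟦ y ∈? C ⟧)
      ≡⟨ sum-cong-≗ pointwise ⟩
    ∑[ y < v ] (1 + ⟦ g ⊕ y ∈? C ⟧ * ⟦ y ∈? C ⟧)
      ≡⟨ ∑-distrib-+ (λ _ → 1) (λ y → ⟦ g ⊕ y ∈? C ⟧ * ⟦ y ∈? C ⟧) ⟩
    ∑[ y < v ] 1 + autocorrelation C g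
      ≡⟨ cong (_+ autocorrelation C g) (trans (∑-const v 1) (*-identityʳ v)) ⟩
    v + autocorrelation C g ∎
    where
    open ≡-Reasoning
    ⟦∈∁⟧ : ∀ x → ⟦ x ∈? ∁ C ⟧ ≡ ⟦ ¬? (x ∈? C) ⟧
    ⟦∈∁⟧ x = ⟦⟧-cong (mk⇔ x∈∁p⇒x∉p x∉p⇒x∈∁p) (x ∈? ∁ C) (¬? (x ∈? C))
    pointwise : ∀ y → ⟦ g ⊕ y ∈? ∁ C ⟧ * ⟦ y ∈? ∁ C ⟧ + ⟦ g ⊕ y ∈? C ⟧ + ⟦ y ∈? C ⟧
                      ≡ 1 + ⟦ g ⊕ y ∈? C ⟧ * ⟦ y ∈? C ⟧
    pointwise y = trans (cong₂ (λ s t → s * t + ⟦ g ⊕ y ∈? C ⟧ + ⟦ y ∈? C ⟧) (⟦∈∁⟧ (g ⊕ y)) (⟦∈∁⟧ y))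
                        (inclusion-exclusion (g ⊕ y ∈? C) (y ∈? C))

  ∑-autocorrelation : ∀ C → ∑[ g < v ] autocorrelation C g ≡ ∣ C ∣ * ∣ C ∣
  ∑-autocorrelation C = begin
    ∑[ g < v ] ∑[ y < v ] (⟦ g ⊕ y ∈? C ⟧ * ⟦ y ∈? C ⟧)
      ≡⟨ ∑-comm (λ g y → ⟦ g ⊕ y ∈? C ⟧ * ⟦ y ∈? C ⟧) ⟩
    ∑[ y < v ] ∑[ g < v ] (⟦ g ⊕ y ∈? C ⟧ * ⟦ y ∈? C ⟧)
      ≡⟨ sum-cong-≗ (λ y → sym (*-distribʳ-sum ⟦ y ∈? C ⟧ (λ g → ⟦ g ⊕ y ∈? C ⟧))) ⟩
    ∑[ y < v ] (∑[ g < v ] ⟦ g ⊕ y ∈? C ⟧ * ⟦ y ∈? C ⟧)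
      ≡⟨ sum-cong-≗ (λ y → cong (_* ⟦ y ∈? C ⟧) (translate y)) ⟩
    ∑[ y < v ] (∣ C ∣ * ⟦ y ∈? C ⟧)
      ≡⟨ sym (*-distribˡ-sum ∣ C ∣ (λ y → ⟦ y ∈? C ⟧)) ⟩
    ∣ C ∣ * ∑[ y < v ] ⟦ y ∈? C ⟧
      ≡⟨ cong (∣ C ∣ *_) (sym (∣p∣≡∑⟦∈⟧ C)) ⟩
    ∣ C ∣ * ∣ C ∣ ∎
    where
    open ≡-Reasoning
    translate : ∀ y → ∑[ g < v ] ⟦ g ⊕ y ∈? C ⟧ ≡ ∣ C ∣
    translate y = trans (∑-translateʳ y (λ x → ⟦ x ∈? C ⟧)) (sym (∣p∣≡∑⟦∈⟧ C))

  autocorrelation-0# : ∀ C → autocorrelation C 0# ≡ ∣ C ∣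
  autocorrelation-0# C = trans
    (sum-cong-≗ (λ y → trans (cong (λ z → ⟦ z ∈? C ⟧ * ⟦ y ∈? C ⟧) (identityˡ y)) (⟦⟧*⟦⟧ (y ∈? C))))
    (sym (∣p∣≡∑⟦∈⟧ C))

  mult-∁ : ∀ C {g} → ¬ g ≡ 0# → mult G (∁ C) g + ∣ C ∣ + ∣ C ∣ ≡ v + mult G C g
  mult-∁ C {g} g≢0 = begin
    mult G (∁ C) g + ∣ C ∣ + ∣ C ∣          ≡⟨ cong (λ m → m + ∣ C ∣ + ∣ C ∣) (mult≡autocorrelation (∁ C) g≢0) ⟩
    autocorrelation (∁ C) g + ∣ C ∣ + ∣ C ∣ ≡⟨ autocorrelation-∁ C g ⟩
    v + autocorrelation C g               ≡⟨ cong (_+_ v) (sym (mult≡autocorrelation C g≢0)) ⟩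
    v + mult G C g                        ∎
    where open ≡-Reasoning

  isDiffFamily₂⇒λ+2k≡v+2mult : ∀ {C lam g} → IsDiffFamily₂ G C lam → ¬ g ≡ 0# →
    lam + 2 * ∣ C ∣ ≡ v + 2 * mult G C g
  isDiffFamily₂⇒λ+2k≡v+2mult {C} {lam} {g} isDF g≢0 = begin
    lam + 2 * ∣ C ∣                       ≡⟨ cong (_+ 2 * ∣ C ∣) (sym (isDF g g≢0)) ⟩
    m + m∁ + 2 * ∣ C ∣                    ≡⟨ regroup m m∁ ∣ C ∣ ⟩
    m + (m∁ + ∣ C ∣ + ∣ C ∣)              ≡⟨ cong (_+_ m) (mult-∁ C g≢0) ⟩
    m + (v + m)                           ≡⟨ regroup′ m v ⟩
    v + 2 * m                             ∎
    where
    open ≡-Reasoning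
    m m∁ : ℕ
    m  = mult G C g
    m∁ = mult G (∁ C) g
    regroup : ∀ a b c → a + b + 2 * c ≡ a + (b + c + c)
    regroup = solve-∀
    regroup′ : ∀ a b → a + (b + a) ≡ b + 2 * a
    regroup′ = solve-∀

  constant-mult⇒μ+∣C∣²≡∣C∣+vμ : ∀ C μ → (∀ g → ¬ g ≡ 0# → mult G C g ≡ μ) → μ + ∣ C ∣ * ∣ C ∣ ≡ ∣ C ∣ + v * μ
  constant-mult⇒μ+∣C∣²≡∣C∣+vμ C μ constant = begin
    μ + ∣ C ∣ * ∣ C ∣
      ≡⟨ cong₂ _+_ (sym (∑-select (λ _ → μ) 0#)) (sym (∑-autocorrelation C)) ⟩
    ∑[ g < v ] (μ * ⟦ g ≟ 0# ⟧) + ∑[ g < v ] autocorrelation C g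
      ≡⟨ sym (∑-distrib-+ (λ g → μ * ⟦ g ≟ 0# ⟧) (autocorrelation C)) ⟩
    ∑[ g < v ] (μ * ⟦ g ≟ 0# ⟧ + autocorrelation C g)
      ≡⟨ sum-cong-≗ pointwise ⟩
    ∑[ g < v ] (∣ C ∣ * ⟦ g ≟ 0# ⟧ + μ)
      ≡⟨ ∑-distrib-+ (λ g → ∣ C ∣ * ⟦ g ≟ 0# ⟧) (λ _ → μ) ⟩
    ∑[ g < v ] (∣ C ∣ * ⟦ g ≟ 0# ⟧) + ∑[ g < v ] μ
      ≡⟨ cong₂ _+_ (∑-select (λ _ → ∣ C ∣) 0#) (∑-const v μ) ⟩
    ∣ C ∣ + v * μ ∎
    where
    open ≡-Reasoning
    pointwise : ∀ g → μ * ⟦ g ≟ 0# ⟧ + autocorrelation C g ≡ ∣ C ∣ * ⟦ g ≟ 0# ⟧ + μ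
    pointwise g with g ≟ 0#
    ... | yes refl = begin
      μ * 1 + autocorrelation C 0#  ≡⟨ cong₂ _+_ (*-identityʳ μ) (autocorrelation-0# C) ⟩
      μ + ∣ C ∣                     ≡⟨ +-comm μ ∣ C ∣ ⟩
      ∣ C ∣ + μ                     ≡⟨ cong (_+ μ) (sym (*-identityʳ ∣ C ∣)) ⟩
      ∣ C ∣ * 1 + μ                 ∎
    ... | no g≢0 = begin
      μ * 0 + autocorrelation C g   ≡⟨ cong₂ _+_ (*-zeroʳ μ) (sym (mult≡autocorrelation C g≢0)) ⟩
      mult G C g                    ≡⟨ constant g g≢0 ⟩
      μ                             ≡⟨ cong (_+ μ) (sym (*-zeroʳ ∣ C ∣)) ⟩
      ∣ C ∣ * 0 + μ                 ∎

hadamard-order : ∀ {V K M L : ℤ} → L +ℤ + 2 *ℤ K ≡ V +ℤ + 2 *ℤ M → V ≡ + 2 *ℤ L → V ≡ + 4 *ℤ (K - M)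
hadamard-order {K = K} {M} {L} eq refl = begin
  + 2 *ℤ L                                          ≡⟨ expand L K M ⟩
  + 4 *ℤ (K - M) +ℤ + 2 *ℤ (rhs - (L +ℤ + 2 *ℤ K))  ≡⟨ cong (λ t → + 4 *ℤ (K - M) +ℤ + 2 *ℤ (rhs - t)) eq ⟩
  + 4 *ℤ (K - M) +ℤ + 2 *ℤ (rhs - rhs)              ≡⟨ cancel (+ 4 *ℤ (K - M)) rhs ⟩
  + 4 *ℤ (K - M)                                    ∎
  where
  open ≡-Reasoning
  rhs : ℤ
  rhs = + 2 *ℤ L +ℤ + 2 *ℤ M
  expand : ∀ L K M → + 2 *ℤ L ≡ + 4 *ℤ (K - M) +ℤ + 2 *ℤ (+ 2 *ℤ L +ℤ + 2 *ℤ M - (L +ℤ + 2 *ℤ K))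
  expand = solve-∀ℤ
  cancel : ∀ a b → a +ℤ + 2 *ℤ (b - b) ≡ a
  cancel = solve-∀ℤ

hadamard-square : ∀ {V K M : ℤ} → V ≡ + 4 *ℤ (K - M) → M +ℤ K *ℤ K ≡ K +ℤ V *ℤ M →
  (K - + 2 *ℤ M) *ℤ (K - + 2 *ℤ M) ≡ K - M
hadamard-square {K = K} {M} refl eq = begin
  (K - + 2 *ℤ M) *ℤ (K - + 2 *ℤ M)                     ≡⟨ expand K M ⟩
  M +ℤ K *ℤ K - + 4 *ℤ (K - M) *ℤ M - M                ≡⟨ cong (λ t → t - + 4 *ℤ (K - M) *ℤ M - M) eq ⟩
  K +ℤ + 4 *ℤ (K - M) *ℤ M - + 4 *ℤ (K - M) *ℤ M - M  ≡⟨ cancel K (+ 4 *ℤ (K - M) *ℤ M) M ⟩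
  K - M                                                ∎
  where
  open ≡-Reasoning
  expand : ∀ K M → (K - + 2 *ℤ M) *ℤ (K - + 2 *ℤ M) ≡ M +ℤ K *ℤ K - + 4 *ℤ (K - M) *ℤ M - M
  expand = solve-∀ℤ
  cancel : ∀ K a M → K +ℤ a - a - M ≡ K - M
  cancel = solve-∀ℤ

+-*-cast : ∀ a b c d e f → a + b * c ≡ d + e * f → + a +ℤ + b *ℤ + c ≡ + d +ℤ + e *ℤ + f
+-*-cast a b c d e f eq = begin
  + a +ℤ + b *ℤ + c  ≡⟨ cong (+ a +ℤ_) (sym (pos-* b c)) ⟩
  + (a + b * c)      ≡⟨ cong +_ eq ⟩
  + (d + e * f)      ≡⟨ cong (+ d +ℤ_) (pos-* e f) ⟩
  + d +ℤ + e *ℤ + f  ∎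
  where open ≡-Reasoning

hadamard-parameters : ∀ v k μ lam → lam + 2 * k ≡ v + 2 * μ → v ≡ 2 * lam → μ + k * k ≡ k + v * μ →
  ∃ λ (u : ℤ) → (+ v ≡ + 4 *ℤ (u *ℤ u)) × (+ k ≡ + 2 *ℤ (u *ℤ u) - u) × (+ μ ≡ u *ℤ u - u)
hadamard-parameters v k μ lam λ-eq v≡2λ count-eq = u , v≡4u² , k≡2u²-u , μ≡u²-u
  where
  u : ℤ
  u = + k - + 2 *ℤ + μ
  order : + v ≡ + 4 *ℤ (+ k - + μ)
  order = hadamard-order {+ v} {+ k} {+ μ} {+ lam} (+-*-cast lam 2 k v 2 μ λ-eq) (trans (cong +_ v≡2λ) (pos-* 2 lam))
  square : u *ℤ u ≡ + k - + μ
  square = hadamard-square {+ v} {+ k} {+ μ} order (+-*-cast μ k k k v μ count-eq)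
  v≡4u² : + v ≡ + 4 *ℤ (u *ℤ u)
  v≡4u² = trans order (cong (+ 4 *ℤ_) (sym square))
  k≡2u²-u : + k ≡ + 2 *ℤ (u *ℤ u) - u
  k≡2u²-u = trans (k-identity (+ k) (+ μ)) (cong (λ t → + 2 *ℤ t - u) (sym square))
    where
    k-identity : ∀ K M → K ≡ + 2 *ℤ (K - M) - (K - + 2 *ℤ M)
    k-identity = solve-∀ℤ
  μ≡u²-u : + μ ≡ u *ℤ u - u
  μ≡u²-u = trans (μ-identity (+ k) (+ μ)) (cong (_- u) (sym square))
    where
    μ-identity : ∀ K M → M ≡ (K - M) - (K - + 2 *ℤ M)
    μ-identity = solve-∀ℤ

proposition2p3 : (v : ℕ) (G : FinGroup v) (B : Subset v) (lam : ℕ) →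
    IsPDF₂ G B lam →
    (∃ λ μ → IsDiffSet G B ∣ B ∣ μ) ×
    (v ≡ 2 * lam →
      ∃ λ (u : ℤ) → (+ v ≡ + 4 *ℤ (u *ℤ u)) ×
        (((∃ λ k → ∃ λ μ → IsDiffSet G B k μ × + k ≡ + 2 *ℤ (u *ℤ u) - u × + μ ≡ u *ℤ u - u))
         ⊎ (∃ λ k → ∃ λ μ → IsDiffSet G (∁ B) k μ × + k ≡ + 2 *ℤ (u *ℤ u) - u × + μ ≡ u *ℤ u - u)))
proposition2p3 v G B lam ((x₀ , x₀∈B) , (y₀ , y₀∈∁B) , isDF) = (μ , refl , constant) , λ v≡2λ →
  -- u = ∣ B ∣ − 2μ may be negative, so B itself always realises the parameters.
  let u , v≡4u² , k≡2u²-u , μ≡u²-u =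
        hadamard-parameters v ∣ B ∣ μ lam (λ-eq _ g₀≢0) v≡2λ (constant-mult⇒μ+∣C∣²≡∣C∣+vμ G B μ constant)
  in u , v≡4u² , inj₁ (∣ B ∣ , μ , (refl , constant) , k≡2u²-u , μ≡u²-u)
  where
  open FinGroup G using (0#) renaming (_-_ to _⊖_)
  open GroupProperties (group G) using (x∙y⁻¹≈ε⇒x≈y)

  g₀≢0 : ¬ x₀ ⊖ y₀ ≡ 0#
  g₀≢0 g₀≡0 = x∈∁p⇒x∉p y₀∈∁B (subst (_∈ B) (x∙y⁻¹≈ε⇒x≈y x₀ y₀ g₀≡0) x₀∈B)

  μ : ℕ
  μ = mult G B (x₀ ⊖ y₀)

  λ-eq : ∀ g → ¬ g ≡ 0# → lam + 2 * ∣ B ∣ ≡ v + 2 * mult G B g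
  λ-eq g = isDiffFamily₂⇒λ+2k≡v+2mult G isDF

  constant : ∀ g → ¬ g ≡ 0# → mult G B g ≡ μ
  constant g g≢0 = *-cancelˡ-≡ _ _ 2 (+-cancelˡ-≡ v _ _ (trans (sym (λ-eq g g≢0)) (λ-eq _ g₀≢0)))
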